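{- Let $t,u$ be $\lambda$-terms and let $d\colon t\to_{\beta_f}^* u$ be a derivation in the fireball calculus. Then there exist vsub-terms $s,r$ and a derivation $e\colon t\to_{\mathsf{vsub}}^* r$ such that: (1) (qualitative) $r\equiv s$, $u = s{\downarrow} = r{\downarrow}$, and $s$ is clean; (2) (quantitative) (a) $|d| = |e|_{\mathtt m}$ (the length of $d$ equals the number of $\mathtt m$-steps of $e$); (b) $|d|_{\beta_\lambda} = |e|_{\mathtt e_\lambda} = |e|_{\mathtt e}$; (3) (normal forms) if $u$ is $\beta_f$-normal, then there is a derivation $g\colon r\to_{\mathtt e_{\mathtt{var}}}^* q$ such that $q$ is $\mathsf{vsub}$-normal and $|g|_{\mathtt e_{\mathtt{var}}}\le |e|_{\mathtt m}-|e|_{\mathtt e_\lambda}$.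
   Context: $\lambda$-terms: $t,u,s::= v\mid tu$, values $v::= x\mid \lambda x.t$, up to $\alpha$-equivalence; $\mathrm{fv}(t)$ is the set of free variables; $t\{x\leftarrow u\}$ is capture-avoiding substitution. Evaluation contexts $E::=\langle\cdot\rangle\mid tE\mid Et$ (no reduction under $\lambda$). Fireball calculus: fireballs $f::=\lambda x.t\mid i$ and inert terms $i::= x f_1\dots f_n$ ($n\ge 0$, application left-associative), defined by mutual induction. $\to_{\beta_\lambda}$ and $\to_{\beta_i}$ are the closures under evaluation contexts of $(\lambda x.t)(\lambda y.u)\mapsto t\{x\leftarrow \lambda y.u\}$ and $(\lambda x.t)i\mapsto t\{x\leftarrow i\}$ ($i$ inert); $\to_{\beta_f}=\to_{\beta_\lambda}\cup\to_{\beta_i}$. Value substitution calculus: vsub-terms $t,u,s::= v\mid tu\mid t[x\leftarrow u]$ with vsub-values $v::=x\mid\lambda x.t$; the explicit substitution $t[x\leftarrow u]$ binds $x$ in $t$; terms up to $\alpha$. Every $\lambda$-term is a vsub-term. Evaluation contexts $E::=\langle\cdot\rangle\mid tE\mid Et\mid E[x\leftarrow u]\mid t[x\leftarrow E]$; substitution contexts $L::=\langle\cdot\rangle\mid L[x\leftarrow u]$. Root rules: $L\langle\lambda x.t\rangle u\mapsto_{\mathtt m} L\langle t[x\leftarrow u]\rangle$; $t[x\leftarrow L\langle \lambda y.u\rangle]\mapsto_{\mathtt e_\lambda} L\langle t\{x\leftarrow\lambda y.u\}\rangle$; $t[x\leftarrow L\langle y\rangle]\mapsto_{\mathtt e_{\mathtt{var}}}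 L\langle t\{x\leftarrow y\}\rangle$ (variables bound by $L$ not free in $u$, resp. $t$). $\to_{\mathtt m},\to_{\mathtt e_\lambda},\to_{\mathtt e_{\mathtt{var}}}$ are their closures under evaluation contexts; $\to_{\mathtt e}=\to_{\mathtt e_\lambda}\cup\to_{\mathtt e_{\mathtt{var}}}$, $\to_{\mathsf{vsub}}=\to_{\mathtt m}\cup\to_{\mathtt e}$. Structural equivalence $\equiv$: the least equivalence relation on vsub-terms closed under evaluation contexts containing $t[y\leftarrow s][x\leftarrow u]\equiv t[x\leftarrow u][y\leftarrow s]$ if $y\notin\mathrm{fv}(u)$, $x\notin\mathrm{fv}(s)$; $t\,(s[x\leftarrow u])\equiv (ts)[x\leftarrow u]$ if $x\notin\mathrm{fv}(t)$; $t[x\leftarrow u]\,s\equiv (ts)[x\leftarrow u]$ if $x\notin\mathrm{fv}(s)$; $t[x\leftarrow u[y\leftarrow s]]\equiv t[x\leftarrow u][y\leftarrow s]$ if $y\notin\mathrm{fv}(t)$. Unfolding: $x{\downarrow}=x$, $(tu){\downarrow}=t{\downarrow}u{\downarrow}$, $(\lambda x.t){\downarrow}=\lambda x.t{\downarrow}$, $(t[x\leftarrow u]){\downarrow}=t{\downarrow}\{x\leftarrow u{\downarrow}\}$. A vsub-term is clean if it has the form $u[x_1\leftarrow i_1]\dots[x_n\leftarrow i_n]$ ($n\ge0$) with $u$ a $\lambda$-term (its body) and $i_1,\dots,i_n$ inert $\lambda$-terms. Rewriting notation: a derivation $d\colon t\to^* u$ is a finite sequence of steps; $|d|$ is its length and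 $|d|_{\mathsf r}$ the number of its $\mathsf r$-steps; $t$ is $\mathsf r$-normal if no $\mathsf r$-step applies to it. -}

module Defs where

open import Data.Nat using (ℕ; zero; suc; _+_)
open import Data.Fin using (Fin; zero; suc)
open import Data.Bool using (Bool; true; false)
open import Data.Product using (Σ; _×_; _,_)
open import Relation.Binary.PropositionalEquality using (_≡_)
open import Relation.Nullary using (¬_)

-- Terms are represented with scoped de Bruijn indices, so that terms
-- "up to α-equivalence" are just elements of the data types below.

data Tm (n : ℕ) : Set where
  var : Fin n → Tm n
  lam : Tm (suc n) → Tm n
  app : Tm n → Tm n → Tm n

Ren : ℕ → ℕ → Set
Ren n m = Fin n → Fin m

liftR : ∀ {n m} → Ren n m → Ren (suc n) (suc m)
liftR ρ zero    = zero
liftR ρ (suc x) = suc (ρ x)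

ren : ∀ {n m} → Ren n m → Tm n → Tm m
ren ρ (var x)   = var (ρ x)
ren ρ (lam t)   = lam (ren (liftR ρ) t)
ren ρ (app t u) = app (ren ρ t) (ren ρ u)

liftS : ∀ {n m} → (Fin n → Tm m) → Fin (suc n) → Tm (suc m)
liftS σ zero    = var zero
liftS σ (suc x) = ren suc (σ x)

sub : ∀ {n m} → (Fin n → Tm m) → Tm n → Tm m
sub σ (var x)   = σ x
sub σ (lam t)   = lam (sub (liftS σ) t)
sub σ (app t u) = app (sub σ t) (sub σ u)

_⟨0≔_⟩ : ∀ {n} → Tm (suc n) → Tm n → Tm n
t ⟨0≔ u ⟩ = sub (λ x → single x) t
  where
  single : _ → _
  single zero    = u
  single (suc x) = var x

mutual
  data Fireball {n : ℕ} : Tm n → Set where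
    f-lam : ∀ t → Fireball (lam t)
    f-in  : ∀ {i} → Inert i → Fireball i

  data Inert {n : ℕ} : Tm n → Set where
    i-var : ∀ x → Inert (var x)
    i-app : ∀ {i f} → Inert i → Fireball f → Inert (app i f)

data FLabel : Set where
  βλ βi : FLabel

data _⟶f[_]_ {n : ℕ} : Tm n → FLabel → Tm n → Set where
  root-λ : ∀ t u → app (lam t) (lam u) ⟶f[ βλ ] (t ⟨0≔ lam u ⟩)
  root-i : ∀ t {i} → Inert i → app (lam t) i ⟶f[ βi ] (t ⟨0≔ i ⟩)
  appL   : ∀ {t t' l} u → t ⟶f[ l ] t' → app t u ⟶f[ l ] app t' u
  appR   : ∀ {u u' l} t → u ⟶f[ l ] u' → app t u ⟶f[ l ] app t u'

β-f-normal : ∀ {n} → Tm n → Set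
β-f-normal t = ∀ l t' → ¬ (t ⟶f[ l ] t')

data Deriv {A L : Set} (R : A → L → A → Set) : A → A → Set where
  []  : ∀ {a} → Deriv R a a
  _∷_ : ∀ {a l b c} → R a l b → Deriv R b c → Deriv R a c

countWhere : ∀ {A L : Set} {R : A → L → A → Set} {a b : A} →
             (L → Bool) → Deriv R a b → ℕ
countWhere P [] = 0
countWhere P (_∷_ {l = l} s d) with P l
... | true  = suc (countWhere P d)
... | false = countWhere P d

len : ∀ {A L : Set} {R : A → L → A → Set} {a b : A} → Deriv R a b → ℕ
len = countWhere (λ _ → true)

data VTm (n : ℕ) : Set where
  vvar : Fin n → VTm n
  vlam : VTm (suc n) → VTm n
  vapp : VTm n → VTm n → VTm n
  es   : VTm (suc n) → VTm n → VTm n   -- es t u  is  t[x←u], x = index 0 in t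

vren : ∀ {n m} → Ren n m → VTm n → VTm m
vren ρ (vvar x)   = vvar (ρ x)
vren ρ (vlam t)   = vlam (vren (liftR ρ) t)
vren ρ (vapp t u) = vapp (vren ρ t) (vren ρ u)
vren ρ (es t u)   = es (vren (liftR ρ) t) (vren ρ u)

vliftS : ∀ {n m} → (Fin n → VTm m) → Fin (suc n) → VTm (suc m)
vliftS σ zero    = vvar zero
vliftS σ (suc x) = vren suc (σ x)

vsub : ∀ {n m} → (Fin n → VTm m) → VTm n → VTm m
vsub σ (vvar x)   = σ x
vsub σ (vlam t)   = vlam (vsub (vliftS σ) t)
vsub σ (vapp t u) = vapp (vsub σ t) (vsub σ u)
vsub σ (es t u)   = es (vsub (vliftS σ) t) (vsub σ u)

_⟪0≔_⟫ : ∀ {n} → VTm (suc n) → VTm n → VTm n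
t ⟪0≔ u ⟫ = vsub single t
  where
  single : _ → _
  single zero    = u
  single (suc x) = vvar x

emb : ∀ {n} → Tm n → VTm n
emb (var x)   = vvar x
emb (lam t)   = vlam (emb t)
emb (app t u) = vapp (emb t) (emb u)

-- substitution contexts L ::= ⟨⟩ | L[x←u];
-- SCtx n m: the whole term lives in scope n, the hole in scope m
data SCtx : ℕ → ℕ → Set where
  hole   : ∀ {n} → SCtx n n
  _[≔_]  : ∀ {n m} → SCtx (suc n) m → VTm n → SCtx n m

plug : ∀ {n m} → SCtx n m → VTm m → VTm n
plug hole        t = t
plug (L [≔ u ]) t = es (plug L t) u

-- weakening from the outer scope to the hole scope (skipping the
-- variables bound by L): expresses "variables bound by L are not free"
wkL : ∀ {n m} → SCtx n m → Ren n m
wkL hole        x = x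
wkL (L [≔ u ]) x = wkL L (suc x)

data VLabel : Set where
  m eλ evar : VLabel

data _⟶v[_]_ : ∀ {n} → VTm n → VLabel → VTm n → Set where
  root-m    : ∀ {n k} (L : SCtx n k) t u →
              vapp (plug L (vlam t)) u ⟶v[ m ] plug L (es t (vren (wkL L) u))
  root-eλ   : ∀ {n k} (L : SCtx n k) t v →
              es t (plug L (vlam v)) ⟶v[ eλ ]
                 plug L ((vren (liftR (wkL L)) t) ⟪0≔ vlam v ⟫)
  root-evar : ∀ {n k} (L : SCtx n k) t (y : Fin k) →
              es t (plug L (vvar y)) ⟶v[ evar ]
                 plug L ((vren (liftR (wkL L)) t) ⟪0≔ vvar y ⟫)
  appL : ∀ {n} {t t' : VTm n} {l} u → t ⟶v[ l ] t' → vapp t u ⟶v[ l ] vapp t' u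
  appR : ∀ {n} {u u' : VTm n} {l} t → u ⟶v[ l ] u' → vapp t u ⟶v[ l ] vapp t u'
  esL  : ∀ {n} {t t' : VTm (suc n)} {l} u → t ⟶v[ l ] t' → es t u ⟶v[ l ] es t' u
  esR  : ∀ {n} {u u' : VTm n} {l} t → u ⟶v[ l ] u' → es t u ⟶v[ l ] es t u'

vsub-normal : ∀ {n} → VTm n → Set
vsub-normal t = ∀ l t' → ¬ (t ⟶v[ l ] t')

isM isEλ isE isEvar : VLabel → Bool
isM m = true
isM _ = false
isEλ eλ = true
isEλ _  = false
isE m = false
isE _ = true
isEvar evar = true
isEvar _    = false

isβλ : FLabel → Bool
isβλ βλ = true
isβλ βi = false

EvarStep : ∀ {n} → VTm n → VLabel → VTm n → Set
EvarStep t l u = (l ≡ evar) × (t ⟶v[ l ] u)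

swap01 : ∀ {n} → Ren (suc (suc n)) (suc (suc n))
swap01 zero          = suc zero
swap01 (suc zero)    = zero
swap01 (suc (suc x)) = suc (suc x)

data _≡s_ : ∀ {n} → VTm n → VTm n → Set where
  -- t[y←s][x←u] ≡ t[x←u][y←s]   (x ∉ fv(s) : s is a weakening;
  --                               y ∉ fv(u) : built into de Bruijn scoping)
  ax-com  : ∀ {n} (t : VTm (suc (suc n))) (s u : VTm n) →
            es (es t (vren suc s)) u ≡s es (es (vren swap01 t) (vren suc u)) s
  -- t (s[x←u]) ≡ (t s)[x←u]   (x ∉ fv(t))
  ax-appR : ∀ {n} (t : VTm n) (s : VTm (suc n)) (u : VTm n) →
            vapp t (es s u) ≡s es (vapp (vren suc t) s) u
  -- t[x←u] s ≡ (t s)[x←u]   (x ∉ fv(s))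
  ax-appL : ∀ {n} (t : VTm (suc n)) (u s : VTm n) →
            vapp (es t u) s ≡s es (vapp t (vren suc s)) u
  -- t[x←u[y←s]] ≡ t[x←u][y←s]   (y ∉ fv(t))
  ax-es   : ∀ {n} (t : VTm (suc n)) (u : VTm (suc n)) (s : VTm n) →
            es t (es u s) ≡s es (es (vren (liftR suc) t) u) s
  ≡s-refl  : ∀ {n} {t : VTm n} → t ≡s t
  ≡s-sym   : ∀ {n} {t u : VTm n} → t ≡s u → u ≡s t
  ≡s-trans : ∀ {n} {t u s : VTm n} → t ≡s u → u ≡s s → t ≡s s
  c-appL : ∀ {n} {t t' : VTm n} u → t ≡s t' → vapp t u ≡s vapp t' u
  c-appR : ∀ {n} {u u' : VTm n} t → u ≡s u' → vapp t u ≡s vapp t u'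
  c-esL  : ∀ {n} {t t' : VTm (suc n)} u → t ≡s t' → es t u ≡s es t' u
  c-esR  : ∀ {n} {u u' : VTm n} t → u ≡s u' → es t u ≡s es t u'

unf : ∀ {n} → VTm n → Tm n
unf (vvar x)   = var x
unf (vapp t u) = app (unf t) (unf u)
unf (vlam t)   = lam (unf t)
unf (es t u)   = unf t ⟨0≔ unf u ⟩

data Clean : ∀ {n} → VTm n → Set where
  c-body : ∀ {n} (u : Tm n) → Clean (emb u)
  c-es   : ∀ {n} {t : VTm (suc n)} {i : Tm n} → Clean t → Inert i → Clean (es t (emb i))

-- Each β_f-step of the unfolding of a vsub-term r is simulated on r by an m-step, followed by an
-- eλ-step when the argument is an abstraction.  This works for the terms reachable from a λ-term
-- (Proper): their explicit substitutions hold terms unfolding to inert terms, and substituting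
-- inert terms creates no redex, so every redex of the unfolding is already a redex of r up to
-- substitution contexts.  Counting explicit substitutions gives #es r + |e|_eλ = |e|_m.  Pushing
-- the substitutions of a proper term outwards by ≡ yields a clean term; and when the unfolding is
-- a fireball, firing by one e_var-step each substitution that holds a variable reaches a
-- vsub-normal form, so at most #es r = |e|_m ∸ |e|_eλ such steps are needed.

module Submission where

open import Defs
open import Data.Nat using (ℕ; zero; suc; _+_; _≤_; _∸_; z≤n; s≤s)
open import Data.Nat.Properties
  using (+-identityʳ; +-assoc; +-suc; +-comm; +-commutativeSemigroup; +-mono-≤; m≤n⇒m≤1+n; m+n∸n≡m)
open import Algebra.Properties.CommutativeSemigroup +-commutativeSemigroup using (x∙yz≈y∙xz)
open import Data.Fin using (Fin; zero; suc)
open import Data.Bool using (Bool; true; false)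
open import Data.Product using (Σ; _×_; _,_)
open import Data.Empty using (⊥-elim)
open import Function using (_∘_; id)
open import Level using (0ℓ)
open import Relation.Binary.Bundles using (Setoid)
import Relation.Binary.Reasoning.Setoid as SetoidReasoning
open import Relation.Binary.PropositionalEquality
  using (_≡_; _≢_; refl; sym; trans; cong; cong₂; subst; _≗_; module ≡-Reasoning)

liftR-cong : ∀ {n m} {ρ ρ' : Ren n m} → ρ ≗ ρ' → liftR ρ ≗ liftR ρ'
liftR-cong p zero    = refl
liftR-cong p (suc x) = cong suc (p x)

ren-cong : ∀ {n m} {ρ ρ' : Ren n m} → ρ ≗ ρ' → ren ρ ≗ ren ρ'
ren-cong p (var x)   = cong var (p x)
ren-cong p (lam t)   = cong lam (ren-cong (liftR-cong p) t)
ren-cong p (app t u) = cong₂ app (ren-cong p t) (ren-cong p u)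

liftR-∘ : ∀ {n m k} (ρ : Ren m k) (ρ' : Ren n m) → liftR ρ ∘ liftR ρ' ≗ liftR (ρ ∘ ρ')
liftR-∘ ρ ρ' zero    = refl
liftR-∘ ρ ρ' (suc x) = refl

ren-ren : ∀ {n m k} (ρ : Ren m k) (ρ' : Ren n m) → ren ρ ∘ ren ρ' ≗ ren (ρ ∘ ρ')
ren-ren ρ ρ' (var x)   = refl
ren-ren ρ ρ' (lam t)   =
  cong lam (trans (ren-ren (liftR ρ) (liftR ρ') t) (ren-cong (liftR-∘ ρ ρ') t))
ren-ren ρ ρ' (app t u) = cong₂ app (ren-ren ρ ρ' t) (ren-ren ρ ρ' u)

liftS-cong : ∀ {n m} {σ σ' : Fin n → Tm m} → σ ≗ σ' → liftS σ ≗ liftS σ'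
liftS-cong p zero    = refl
liftS-cong p (suc x) = cong (ren suc) (p x)

sub-cong : ∀ {n m} {σ σ' : Fin n → Tm m} → σ ≗ σ' → sub σ ≗ sub σ'
sub-cong p (var x)   = p x
sub-cong p (lam t)   = cong lam (sub-cong (liftS-cong p) t)
sub-cong p (app t u) = cong₂ app (sub-cong p t) (sub-cong p u)

ren-sub : ∀ {n m k} (ρ : Ren m k) (σ : Fin n → Tm m) → ren ρ ∘ sub σ ≗ sub (ren ρ ∘ σ)
ren-sub ρ σ (var x)   = refl
ren-sub ρ σ (lam t)   = cong lam (trans (ren-sub (liftR ρ) (liftS σ) t) (sub-cong lift-comm t))
  where
  lift-comm : ren (liftR ρ) ∘ liftS σ ≗ liftS (ren ρ ∘ σ)
  lift-comm zero    = refl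
  lift-comm (suc x) = trans (ren-ren (liftR ρ) suc (σ x)) (sym (ren-ren suc ρ (σ x)))
ren-sub ρ σ (app t u) = cong₂ app (ren-sub ρ σ t) (ren-sub ρ σ u)

sub-ren : ∀ {n m k} (σ : Fin m → Tm k) (ρ : Ren n m) → sub σ ∘ ren ρ ≗ sub (σ ∘ ρ)
sub-ren σ ρ (var x)   = refl
sub-ren σ ρ (lam t)   = cong lam (trans (sub-ren (liftS σ) (liftR ρ) t) (sub-cong lift-comm t))
  where
  lift-comm : liftS σ ∘ liftR ρ ≗ liftS (σ ∘ ρ)
  lift-comm zero    = refl
  lift-comm (suc x) = refl
sub-ren σ ρ (app t u) = cong₂ app (sub-ren σ ρ t) (sub-ren σ ρ u)

sub-id : ∀ {n} {σ : Fin n → Tm n} → σ ≗ var → sub σ ≗ id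
sub-id p (var x)   = p x
sub-id {σ = σ} p (lam t) = cong lam (sub-id lift-var t)
  where
  lift-var : liftS σ ≗ var
  lift-var zero    = refl
  lift-var (suc x) = cong (ren suc) (p x)
sub-id p (app t u) = cong₂ app (sub-id p t) (sub-id p u)

sub-sub : ∀ {n m k} (σ : Fin m → Tm k) (τ : Fin n → Tm m) → sub σ ∘ sub τ ≗ sub (sub σ ∘ τ)
sub-sub σ τ (var x)   = refl
sub-sub σ τ (lam t)   = cong lam (trans (sub-sub (liftS σ) (liftS τ) t) (sub-cong lift-comm t))
  where
  lift-comm : sub (liftS σ) ∘ liftS τ ≗ liftS (sub σ ∘ τ)
  lift-comm zero    = refl
  lift-comm (suc x) = trans (sub-ren (liftS σ) suc (τ x)) (sym (ren-sub suc σ (τ x)))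
sub-sub σ τ (app t u) = cong₂ app (sub-sub σ τ t) (sub-sub σ τ u)

liftS-liftR-inverse : ∀ {n m} {σ : Fin m → Tm n} {ρ : Ren n m} → σ ∘ ρ ≗ var →
  liftS σ ∘ liftR ρ ≗ var
liftS-liftR-inverse p zero    = refl
liftS-liftR-inverse p (suc x) = cong (ren suc) (p x)

single : ∀ {n} → Tm n → Fin (suc n) → Tm n
single u zero    = u
single u (suc x) = var x

⟨0≔⟩-sub : ∀ {n} (t : Tm (suc n)) u → t ⟨0≔ u ⟩ ≡ sub (single u) t
⟨0≔⟩-sub t u = sub-cong (λ { zero → refl ; (suc x) → refl }) t

sub-ren-inverse : ∀ {n m} {σ : Fin m → Tm n} {ρ : Ren n m} → σ ∘ ρ ≗ var → sub σ ∘ ren ρ ≗ id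
sub-ren-inverse {σ = σ} {ρ} p t = trans (sub-ren σ ρ t) (sub-id p t)

sub-⟨0≔⟩ : ∀ {n m} (σ : Fin n → Tm m) t u →
  sub σ (t ⟨0≔ u ⟩) ≡ sub (liftS σ) t ⟨0≔ sub σ u ⟩
sub-⟨0≔⟩ σ t u = begin
  sub σ (t ⟨0≔ u ⟩)                         ≡⟨ cong (sub σ) (⟨0≔⟩-sub t u) ⟩
  sub σ (sub (single u) t)                 ≡⟨ sub-sub σ (single u) t ⟩
  sub (sub σ ∘ single u) t                 ≡⟨ sub-cong single-comm t ⟩
  sub (sub (single (sub σ u)) ∘ liftS σ) t ≡⟨ sub-sub (single (sub σ u)) (liftS σ) t ⟨
  sub (single (sub σ u)) (sub (liftS σ) t) ≡⟨ ⟨0≔⟩-sub (sub (liftS σ) t) (sub σ u) ⟨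
  sub (liftS σ) t ⟨0≔ sub σ u ⟩             ∎
  where
  open ≡-Reasoning
  single-comm : sub σ ∘ single u ≗ sub (single (sub σ u)) ∘ liftS σ
  single-comm zero    = refl
  single-comm (suc x) = sym (sub-ren-inverse (λ _ → refl) (σ x))

vren-cong : ∀ {n m} {ρ ρ' : Ren n m} → ρ ≗ ρ' → vren ρ ≗ vren ρ'
vren-cong p (vvar x)   = cong vvar (p x)
vren-cong p (vlam t)   = cong vlam (vren-cong (liftR-cong p) t)
vren-cong p (vapp t u) = cong₂ vapp (vren-cong p t) (vren-cong p u)
vren-cong p (es t u)   = cong₂ es (vren-cong (liftR-cong p) t) (vren-cong p u)

vren-vren : ∀ {n m k} (ρ : Ren m k) (ρ' : Ren n m) → vren ρ ∘ vren ρ' ≗ vren (ρ ∘ ρ')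
vren-vren ρ ρ' (vvar x)   = refl
vren-vren ρ ρ' (vlam t)   =
  cong vlam (trans (vren-vren (liftR ρ) (liftR ρ') t) (vren-cong (liftR-∘ ρ ρ') t))
vren-vren ρ ρ' (vapp t u) = cong₂ vapp (vren-vren ρ ρ' t) (vren-vren ρ ρ' u)
vren-vren ρ ρ' (es t u)   =
  cong₂ es (trans (vren-vren (liftR ρ) (liftR ρ') t) (vren-cong (liftR-∘ ρ ρ') t))
           (vren-vren ρ ρ' u)

vren-liftR-vren : ∀ {n m k} (ρ : Ren m k) (ρ' : Ren n m) t →
  vren (liftR ρ) (vren (liftR ρ') t) ≡ vren (liftR (ρ ∘ ρ')) t
vren-liftR-vren ρ ρ' t = trans (vren-vren (liftR ρ) (liftR ρ') t) (vren-cong (liftR-∘ ρ ρ') t)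

liftR-id : ∀ {n} {ρ : Ren n n} → ρ ≗ id → liftR ρ ≗ id
liftR-id p zero    = refl
liftR-id p (suc x) = cong suc (p x)

vren-id : ∀ {n} {ρ : Ren n n} → ρ ≗ id → vren ρ ≗ id
vren-id p (vvar x)   = cong vvar (p x)
vren-id p (vlam t)   = cong vlam (vren-id (liftR-id p) t)
vren-id p (vapp t u) = cong₂ vapp (vren-id p t) (vren-id p u)
vren-id p (es t u)   = cong₂ es (vren-id (liftR-id p) t) (vren-id p u)

vliftS-cong : ∀ {n m} {σ σ' : Fin n → VTm m} → σ ≗ σ' → vliftS σ ≗ vliftS σ'
vliftS-cong p zero    = refl
vliftS-cong p (suc x) = cong (vren suc) (p x)

vsub-cong : ∀ {n m} {σ σ' : Fin n → VTm m} → σ ≗ σ' → vsub σ ≗ vsub σ'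
vsub-cong p (vvar x)   = p x
vsub-cong p (vlam t)   = cong vlam (vsub-cong (vliftS-cong p) t)
vsub-cong p (vapp t u) = cong₂ vapp (vsub-cong p t) (vsub-cong p u)
vsub-cong p (es t u)   = cong₂ es (vsub-cong (vliftS-cong p) t) (vsub-cong p u)

vliftS-vvar : ∀ {n m} (ρ : Ren n m) → vliftS (vvar ∘ ρ) ≗ vvar ∘ liftR ρ
vliftS-vvar ρ zero    = refl
vliftS-vvar ρ (suc x) = refl

vsub-vvar : ∀ {n m} (ρ : Ren n m) → vsub (vvar ∘ ρ) ≗ vren ρ
vsub-vvar ρ (vvar x)   = refl
vsub-vvar ρ (vlam t)   = cong vlam (trans (vsub-cong (vliftS-vvar ρ) t) (vsub-vvar (liftR ρ) t))
vsub-vvar ρ (vapp t u) = cong₂ vapp (vsub-vvar ρ t) (vsub-vvar ρ u)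
vsub-vvar ρ (es t u)   =
  cong₂ es (trans (vsub-cong (vliftS-vvar ρ) t) (vsub-vvar (liftR ρ) t)) (vsub-vvar ρ u)

singleR : ∀ {n} → Fin n → Ren (suc n) n
singleR y zero    = y
singleR y (suc x) = x

⟪0≔vvar⟫-vren : ∀ {n} (t : VTm (suc n)) y → t ⟪0≔ vvar y ⟫ ≡ vren (singleR y) t
⟪0≔vvar⟫-vren t y =
  trans (vsub-cong (λ { zero → refl ; (suc x) → refl }) t) (vsub-vvar (singleR y) t)

vren-emb : ∀ {n m} (ρ : Ren n m) → vren ρ ∘ emb ≗ emb ∘ ren ρ
vren-emb ρ (var x)   = refl
vren-emb ρ (lam t)   = cong vlam (vren-emb (liftR ρ) t)
vren-emb ρ (app t u) = cong₂ vapp (vren-emb ρ t) (vren-emb ρ u)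

vsub-emb : ∀ {n m} (σ : Fin n → Tm m) → vsub (emb ∘ σ) ∘ emb ≗ emb ∘ sub σ
vsub-emb σ (var x)   = refl
vsub-emb σ (lam t)   = cong vlam (trans (vsub-cong lift-emb (emb t)) (vsub-emb (liftS σ) t))
  where
  lift-emb : vliftS (emb ∘ σ) ≗ emb ∘ liftS σ
  lift-emb zero    = refl
  lift-emb (suc x) = vren-emb suc (σ x)
vsub-emb σ (app t u) = cong₂ vapp (vsub-emb σ t) (vsub-emb σ u)

emb-⟪0≔⟫ : ∀ {n} (t : Tm (suc n)) u → emb t ⟪0≔ emb u ⟫ ≡ emb (t ⟨0≔ u ⟩)
emb-⟪0≔⟫ t u = begin
  emb t ⟪0≔ emb u ⟫               ≡⟨ vsub-cong (λ { zero → refl ; (suc x) → refl }) (emb t) ⟩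
  vsub (emb ∘ single u) (emb t)  ≡⟨ vsub-emb (single u) t ⟩
  emb (sub (single u) t)         ≡⟨ cong emb (⟨0≔⟩-sub t u) ⟨
  emb (t ⟨0≔ u ⟩)                 ∎
  where open ≡-Reasoning

unf-emb : ∀ {n} → unf ∘ emb ≗ id {A = Tm n}
unf-emb (var x)   = refl
unf-emb (lam t)   = cong lam (unf-emb t)
unf-emb (app t u) = cong₂ app (unf-emb t) (unf-emb u)

unf-vren : ∀ {n m} (ρ : Ren n m) → unf ∘ vren ρ ≗ ren ρ ∘ unf
unf-vren ρ (vvar x)   = refl
unf-vren ρ (vlam t)   = cong lam (unf-vren (liftR ρ) t)
unf-vren ρ (vapp t u) = cong₂ app (unf-vren ρ t) (unf-vren ρ u)
unf-vren ρ (es t u)   = begin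
  unf (vren (liftR ρ) t) ⟨0≔ unf (vren ρ u) ⟩
    ≡⟨ cong₂ _⟨0≔_⟩ (unf-vren (liftR ρ) t) (unf-vren ρ u) ⟩
  ren (liftR ρ) (unf t) ⟨0≔ ren ρ (unf u) ⟩
    ≡⟨ ⟨0≔⟩-sub (ren (liftR ρ) (unf t)) (ren ρ (unf u)) ⟩
  sub (single (ren ρ (unf u))) (ren (liftR ρ) (unf t)) ≡⟨ sub-ren (single (ren ρ (unf u))) (liftR ρ) (unf t) ⟩
  sub (single (ren ρ (unf u)) ∘ liftR ρ) (unf t)
    ≡⟨ sub-cong (λ { zero → refl ; (suc x) → refl }) (unf t) ⟩
  sub (ren ρ ∘ single (unf u)) (unf t)
    ≡⟨ ren-sub ρ (single (unf u)) (unf t) ⟨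
  ren ρ (sub (single (unf u)) (unf t))
    ≡⟨ cong (ren ρ) (⟨0≔⟩-sub (unf t) (unf u)) ⟨
  ren ρ (unf t ⟨0≔ unf u ⟩) ∎
  where open ≡-Reasoning

sub-unf-vren-inverse : ∀ {n m} {σ : Fin m → Tm n} {ρ : Ren n m} → σ ∘ ρ ≗ var →
  ∀ t → sub σ (unf (vren ρ t)) ≡ unf t
sub-unf-vren-inverse {σ = σ} {ρ} p t = trans (cong (sub σ) (unf-vren ρ t)) (sub-ren-inverse p (unf t))

unf-vliftS : ∀ {n m} (σ : Fin n → VTm m) → unf ∘ vliftS σ ≗ liftS (unf ∘ σ)
unf-vliftS σ zero    = refl
unf-vliftS σ (suc x) = unf-vren suc (σ x)

unf-vsub : ∀ {n m} (σ : Fin n → VTm m) → unf ∘ vsub σ ≗ sub (unf ∘ σ) ∘ unf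
unf-vsub σ (vvar x)   = refl
unf-vsub σ (vlam t)   = cong lam (trans (unf-vsub (vliftS σ) t) (sub-cong (unf-vliftS σ) (unf t)))
unf-vsub σ (vapp t u) = cong₂ app (unf-vsub σ t) (unf-vsub σ u)
unf-vsub σ (es t u)   = begin
  unf (vsub (vliftS σ) t) ⟨0≔ unf (vsub σ u) ⟩
    ≡⟨ cong₂ _⟨0≔_⟩ (unf-vsub-lift t) (unf-vsub σ u) ⟩
  sub (liftS (unf ∘ σ)) (unf t) ⟨0≔ sub (unf ∘ σ) (unf u) ⟩ ≡⟨ sub-⟨0≔⟩ (unf ∘ σ) (unf t) (unf u) ⟨
  sub (unf ∘ σ) (unf t ⟨0≔ unf u ⟩) ∎
  where
  open ≡-Reasoning
  unf-vsub-lift : ∀ t → unf (vsub (vliftS σ) t) ≡ sub (liftS (unf ∘ σ)) (unf t)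
  unf-vsub-lift t = trans (unf-vsub (vliftS σ) t) (sub-cong (unf-vliftS σ) (unf t))

unf-⟪0≔⟫ : ∀ {n} (t : VTm (suc n)) v → unf (t ⟪0≔ v ⟫) ≡ unf t ⟨0≔ unf v ⟩
unf-⟪0≔⟫ t v = trans (unf-vsub _ t) (sub-cong (λ { zero → refl ; (suc x) → refl }) (unf t))

mutual
  Inert-ren : ∀ {n m} (ρ : Ren n m) {i} → Inert i → Inert (ren ρ i)
  Inert-ren ρ (i-var x)   = i-var (ρ x)
  Inert-ren ρ (i-app i f) = i-app (Inert-ren ρ i) (Fireball-ren ρ f)

  Fireball-ren : ∀ {n m} (ρ : Ren n m) {f} → Fireball f → Fireball (ren ρ f)
  Fireball-ren ρ (f-lam t) = f-lam _
  Fireball-ren ρ (f-in i)  = f-in (Inert-ren ρ i)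

mutual
  Inert-sub⁻¹ : ∀ {n m} (σ : Fin n → Tm m) t → Inert (sub σ t) → Inert t
  Inert-sub⁻¹ σ (var x)   _           = i-var x
  Inert-sub⁻¹ σ (app t u) (i-app i f) = i-app (Inert-sub⁻¹ σ t i) (Fireball-sub⁻¹ σ u f)

  Fireball-sub⁻¹ : ∀ {n m} (σ : Fin n → Tm m) t → Fireball (sub σ t) → Fireball t
  Fireball-sub⁻¹ σ (var x)   _        = f-in (i-var x)
  Fireball-sub⁻¹ σ (lam t)   _        = f-lam t
  Fireball-sub⁻¹ σ (app t u) (f-in i) = f-in (Inert-sub⁻¹ σ (app t u) i)

mutual
  Inert⇒normal : ∀ {n} {i : Tm n} → Inert i → β-f-normal i
  Inert⇒normal (i-app i f) l _ (appL _ s) = Inert⇒normal i l _ s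
  Inert⇒normal (i-app i f) l _ (appR _ s) = Fireball⇒normal f l _ s

  Fireball⇒normal : ∀ {n} {f : Tm n} → Fireball f → β-f-normal f
  Fireball⇒normal (f-in i) = Inert⇒normal i

normal⇒Fireball : ∀ {n} (t : Tm n) → β-f-normal t → Fireball t
normal⇒Fireball (var x)   _ = f-in (i-var x)
normal⇒Fireball (lam t)   _ = f-lam t
normal⇒Fireball (app t u) h
  with normal⇒Fireball t (λ l _ s → h l _ (appL u s)) | normal⇒Fireball u (λ l _ s → h l _ (appR t s))
... | f-lam t' | f-lam u' = ⊥-elim (h _ _ (root-λ t' u'))
... | f-lam t' | f-in i   = ⊥-elim (h _ _ (root-i t' i))
... | f-in i   | f        = f-in (i-app i f)

Inert≢lam : ∀ {n} {i : Tm n} {t} → Inert i → i ≢ lam t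
Inert≢lam (i-var x)   ()
Inert≢lam (i-app i f) ()

InertSub : ∀ {n m} → (Fin n → Tm m) → Set
InertSub σ = ∀ x → Inert (σ x)

single-inert : ∀ {n} {i : Tm n} → Inert i → InertSub (single i)
single-inert i zero    = i
single-inert i (suc x) = i-var x

lam-sub⁻¹ : ∀ {n m} {σ : Fin n → Tm m} → InertSub σ → ∀ t {b} → sub σ t ≡ lam b →
  Σ (Tm (suc n)) λ a → t ≡ lam a × sub (liftS σ) a ≡ b
lam-sub⁻¹ inert (var x) e    = ⊥-elim (Inert≢lam (inert x) e)
lam-sub⁻¹ inert (lam a) refl = a , refl , refl

app-injective : ∀ {n} {a b c d : Tm n} → app a b ≡ app c d → a ≡ c × b ≡ d
app-injective refl = refl , refl

-- Inert terms create no redexes when substituted.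
step-sub⁻¹ : ∀ {n m} {σ : Fin n → Tm m} → InertSub σ → ∀ t {s l u} → sub σ t ≡ s → s ⟶f[ l ] u →
  Σ (Tm n) λ t' → (t ⟶f[ l ] t') × sub σ t' ≡ u
step-sub⁻¹ inert (var x) e s = ⊥-elim (Inert⇒normal (subst Inert e (inert x)) _ _ s)
step-sub⁻¹ inert (lam t) refl ()
step-sub⁻¹ {σ = σ} inert (app t₁ t₂) e (root-λ a b) with app-injective e
... | e₁ , e₂ with lam-sub⁻¹ inert t₁ e₁ | lam-sub⁻¹ inert t₂ e₂
... | a₀ , refl , refl | b₀ , refl , refl = a₀ ⟨0≔ lam b₀ ⟩ , root-λ a₀ b₀ , sub-⟨0≔⟩ σ a₀ (lam b₀)
step-sub⁻¹ {σ = σ} inert (app t₁ t₂) e (root-i a i) with app-injective e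
... | e₁ , refl with lam-sub⁻¹ inert t₁ e₁
... | a₀ , refl , refl = a₀ ⟨0≔ t₂ ⟩ , root-i a₀ (Inert-sub⁻¹ σ t₂ i) , sub-⟨0≔⟩ σ a₀ t₂
step-sub⁻¹ inert (app t₁ t₂) e (appL _ s) with app-injective e
... | e₁ , refl with step-sub⁻¹ inert t₁ e₁ s
... | t₁' , s' , refl = app t₁' t₂ , appL t₂ s' , refl
step-sub⁻¹ inert (app t₁ t₂) e (appR _ s) with app-injective e
... | refl , e₂ with step-sub⁻¹ inert t₂ e₂ s
... | t₂' , s' , refl = app t₁ t₂' , appR t₁ s' , refl

mapᵈ : ∀ {A B L : Set} {R : A → L → A → Set} {S : B → L → B → Set} (F : A → B) →
  (∀ {a l b} → R a l b → S (F a) l (F b)) → ∀ {a b} → Deriv R a b → Deriv S (F a) (F b)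
mapᵈ F f []      = []
mapᵈ F f (s ∷ d) = f s ∷ mapᵈ F f d

countWhere-mapᵈ : ∀ {A B L : Set} {R : A → L → A → Set} {S : B → L → B → Set} (F : A → B)
  (f : ∀ {a l b} → R a l b → S (F a) l (F b)) (P : L → Bool) {a b} (d : Deriv R a b) →
  countWhere P (mapᵈ {S = S} F f d) ≡ countWhere P d
countWhere-mapᵈ F f P []                  = refl
countWhere-mapᵈ F f P (_∷_ {l = l} s d) with P l
... | true  = cong suc (countWhere-mapᵈ F f P d)
... | false = countWhere-mapᵈ F f P d

_++ᵈ_ : ∀ {A L : Set} {R : A → L → A → Set} {a b c} → Deriv R a b → Deriv R b c → Deriv R a c
[]      ++ᵈ e = e
(s ∷ d) ++ᵈ e = s ∷ (d ++ᵈ e)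

countWhere-++ᵈ : ∀ {A L : Set} {R : A → L → A → Set} (P : L → Bool) {a b c}
  (d : Deriv R a b) (e : Deriv R b c) →
  countWhere P (d ++ᵈ e) ≡ countWhere P d + countWhere P e
countWhere-++ᵈ P []                  e = refl
countWhere-++ᵈ P (_∷_ {l = l} s d) e with P l
... | true  = cong suc (countWhere-++ᵈ P d e)
... | false = countWhere-++ᵈ P d e

module _ {A B C L : Set} {R : A → L → A → Set} {S : B → L → B → Set} {T : C → L → C → Set}
         (F : A → B → C)
         (left  : ∀ {a l a'} b → R a l a' → T (F a b) l (F a' b))
         (right : ∀ a {b l b'} → S b l b' → T (F a b) l (F a b')) where

  cong₂ᵈ : ∀ {a a' b b'} → Deriv R a a' → Deriv S b b' → Deriv T (F a b) (F a' b')
  cong₂ᵈ {a' = a'} {b = b} d e = mapᵈ (λ z → F z b) (left b) d ++ᵈ mapᵈ (F a') (right a') e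

  countWhere-cong₂ᵈ : ∀ (P : L → Bool) {a a' b b'} (d : Deriv R a a') (e : Deriv S b b') →
    countWhere P (cong₂ᵈ d e) ≡ countWhere P d + countWhere P e
  countWhere-cong₂ᵈ P {a' = a'} {b = b} d e = begin
    countWhere P (cong₂ᵈ d e)
      ≡⟨ countWhere-++ᵈ P (mapᵈ (λ z → F z b) (left b) d) (mapᵈ (F a') (right a') e) ⟩
    countWhere P (mapᵈ (λ z → F z b) (left b) d) + countWhere P (mapᵈ (F a') (right a') e)
      ≡⟨ cong₂ _+_ (countWhere-mapᵈ _ (left b) P d) (countWhere-mapᵈ _ (right a') P e) ⟩
    countWhere P d + countWhere P e ∎
    where open ≡-Reasoning

plug-step : ∀ {n k} (L : SCtx n k) {X Y l} → X ⟶v[ l ] Y → plug L X ⟶v[ l ] plug L Y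
plug-step hole       s = s
plug-step (L [≔ u ]) s = esL u (plug-step L s)

unfL : ∀ {n k} → SCtx n k → Fin k → Tm n
unfL hole       = var
unfL (L [≔ u ]) = sub (single (unf u)) ∘ unfL L

unf-plug : ∀ {n k} (L : SCtx n k) X → unf (plug L X) ≡ sub (unfL L) (unf X)
unf-plug hole       X = sym (sub-id (λ _ → refl) (unf X))
unf-plug (L [≔ u ]) X = begin
  unf (plug L X) ⟨0≔ unf u ⟩                    ≡⟨ ⟨0≔⟩-sub (unf (plug L X)) (unf u) ⟩
  sub (single (unf u)) (unf (plug L X))         ≡⟨ cong (sub (single (unf u))) (unf-plug L X) ⟩
  sub (single (unf u)) (sub (unfL L) (unf X))   ≡⟨ sub-sub (single (unf u)) (unfL L) (unf X) ⟩
  sub (unfL (L [≔ u ])) (unf X)                 ∎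
  where open ≡-Reasoning

unfL-wkL : ∀ {n k} (L : SCtx n k) → unfL L ∘ wkL L ≗ var
unfL-wkL hole       x = refl
unfL-wkL (L [≔ u ]) x = cong (sub (single (unf u))) (unfL-wkL L (suc x))

unf-m-root : ∀ {n k} (L : SCtx n k) b u {T} → unf (plug L (vlam b)) ≡ lam T →
  unf (plug L (es b (vren (wkL L) u))) ≡ T ⟨0≔ unf u ⟩
unf-m-root L b u e with trans (sym (unf-plug L (vlam b))) e
... | refl = begin
  unf (plug L (es b (vren (wkL L) u)))                              ≡⟨ unf-plug L _ ⟩
  sub (unfL L) (unf b ⟨0≔ unf (vren (wkL L) u) ⟩)                    ≡⟨ sub-⟨0≔⟩ (unfL L) (unf b) _ ⟩
  sub (liftS (unfL L)) (unf b) ⟨0≔ sub (unfL L) (unf (vren (wkL L) u)) ⟩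
    ≡⟨ cong (sub (liftS (unfL L)) (unf b) ⟨0≔_⟩) (sub-unf-vren-inverse (unfL-wkL L) u) ⟩
  sub (liftS (unfL L)) (unf b) ⟨0≔ unf u ⟩                           ∎
  where open ≡-Reasoning

unf-e-root : ∀ {n k} (L : SCtx n k) t v →
  unf (es t (plug L v)) ≡ unf (plug L (vren (liftR (wkL L)) t ⟪0≔ v ⟫))
unf-e-root L t v = sym (begin
  unf (plug L (t' ⟪0≔ v ⟫))                                  ≡⟨ unf-plug L _ ⟩
  sub (unfL L) (unf (t' ⟪0≔ v ⟫))                            ≡⟨ cong (sub (unfL L)) (unf-⟪0≔⟫ t' v) ⟩
  sub (unfL L) (unf t' ⟨0≔ unf v ⟩)                          ≡⟨ sub-⟨0≔⟩ (unfL L) (unf t') (unf v) ⟩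
  sub (liftS (unfL L)) (unf t') ⟨0≔ sub (unfL L) (unf v) ⟩
    ≡⟨ cong₂ _⟨0≔_⟩ (sub-unf-vren-inverse (liftS-liftR-inverse (unfL-wkL L)) t) (sym (unf-plug L v)) ⟩
  unf t ⟨0≔ unf (plug L v) ⟩                                 ∎)
  where
  open ≡-Reasoning
  t' : VTm (suc _)
  t' = vren (liftR (wkL L)) t

unf-e-step : ∀ {n} {t t' : VTm n} {l} → t ⟶v[ l ] t' → l ≢ m → unf t ≡ unf t'
unf-e-step (root-m L t u)    l≢m = ⊥-elim (l≢m refl)
unf-e-step (root-eλ L t v)   _   = unf-e-root L t (vlam v)
unf-e-step (root-evar L t y) _   = unf-e-root L t (vvar y)
unf-e-step (appL u s)        l≢m = cong (λ z → app z (unf u)) (unf-e-step s l≢m)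
unf-e-step (appR t s)        l≢m = cong (app (unf t)) (unf-e-step s l≢m)
unf-e-step (esL u s)         l≢m = cong (_⟨0≔ unf u ⟩) (unf-e-step s l≢m)
unf-e-step (esR t s)         l≢m = cong (unf t ⟨0≔_⟩) (unf-e-step s l≢m)

-- The simulation invariant

#es : ∀ {n} → VTm n → ℕ
#es (vvar x)   = 0
#es (vlam t)   = 0
#es (vapp t u) = #es t + #es u
#es (es t u)   = suc (#es t + #es u)

#esL : ∀ {n k} → SCtx n k → ℕ
#esL hole       = 0
#esL (L [≔ u ]) = suc (#esL L + #es u)

#es-plug : ∀ {n k} (L : SCtx n k) X → #es (plug L X) ≡ #es X + #esL L
#es-plug hole       X = sym (+-identityʳ (#es X))
#es-plug (L [≔ u ]) X = begin
  suc (#es (plug L X) + #es u)    ≡⟨ cong (λ z → suc (z + #es u)) (#es-plug L X) ⟩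
  suc (#es X + #esL L + #es u)    ≡⟨ cong suc (+-assoc (#es X) (#esL L) (#es u)) ⟩
  suc (#es X + (#esL L + #es u))  ≡⟨ +-suc (#es X) (#esL L + #es u) ⟨
  #es X + #esL (L [≔ u ])         ∎
  where open ≡-Reasoning

#es-vren : ∀ {n m} (ρ : Ren n m) t → #es (vren ρ t) ≡ #es t
#es-vren ρ (vvar x)   = refl
#es-vren ρ (vlam t)   = refl
#es-vren ρ (vapp t u) = cong₂ _+_ (#es-vren ρ t) (#es-vren ρ u)
#es-vren ρ (es t u)   = cong suc (cong₂ _+_ (#es-vren (liftR ρ) t) (#es-vren ρ u))

#es-emb : ∀ {n} (t : Tm n) → #es (emb t) ≡ 0
#es-emb (var x)   = refl
#es-emb (lam t)   = refl
#es-emb (app t u) = cong₂ _+_ (#es-emb t) (#es-emb u)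

data Proper {n} : VTm n → Set where
  p-var : ∀ x → Proper (vvar x)
  p-lam : ∀ t → Proper (vlam (emb t))
  p-app : ∀ {t u} → Proper t → Proper u → Proper (vapp t u)
  p-es  : ∀ {t u} → Proper t → Proper u → Inert (unf u) → Proper (es t u)

data ProperL : ∀ {n k} → SCtx n k → Set where
  p-hole : ∀ {n} → ProperL (hole {n})
  p-[≔]  : ∀ {n k} {L : SCtx (suc n) k} {u} →
           ProperL L → Proper u → Inert (unf u) → ProperL (L [≔ u ])

emb-Proper : ∀ {n} (t : Tm n) → Proper (emb t)
emb-Proper (var x)   = p-var x
emb-Proper (lam t)   = p-lam t
emb-Proper (app t u) = p-app (emb-Proper t) (emb-Proper u)

Proper-vren : ∀ {n m} (ρ : Ren n m) {t} → Proper t → Proper (vren ρ t)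
Proper-vren ρ (p-var x)       = p-var (ρ x)
Proper-vren ρ (p-lam t)       = subst (Proper ∘ vlam) (sym (vren-emb (liftR ρ) t)) (p-lam (ren (liftR ρ) t))
Proper-vren ρ (p-app p q)     = p-app (Proper-vren ρ p) (Proper-vren ρ q)
Proper-vren ρ (p-es {u = u} p q i) =
  p-es (Proper-vren (liftR ρ) p) (Proper-vren ρ q) (subst Inert (sym (unf-vren ρ u)) (Inert-ren ρ i))

plug-Proper : ∀ {n k} {L : SCtx n k} {X} → ProperL L → Proper X → Proper (plug L X)
plug-Proper p-hole         p = p
plug-Proper (p-[≔] pL q i) p = p-es (plug-Proper pL p) q i

Proper-lam⁻¹ : ∀ {n} {g : VTm n} → Proper g → ∀ {T} → unf g ≡ lam T →
  Σ ℕ λ k → Σ (SCtx n k) λ L → Σ (Tm (suc k)) λ b → ProperL L × g ≡ plug L (vlam (emb b))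
Proper-lam⁻¹ (p-lam t) _ = _ , hole , t , p-hole , refl
Proper-lam⁻¹ (p-es {t} {u} p q i) e
  with lam-sub⁻¹ (single-inert i) (unf t) (trans (sym (⟨0≔⟩-sub (unf t) (unf u))) e)
... | _ , e' , _ with Proper-lam⁻¹ p e'
... | k , L , b , pL , refl = k , L [≔ u ] , b , p-[≔] pL q i , refl

-- Simulation

data Sim {n} : FLabel → VTm n → VTm n → Set where
  sim-βi : ∀ {a b}   → a ⟶v[ m ] b → Sim βi a b
  sim-βλ : ∀ {a b c} → a ⟶v[ m ] b → b ⟶v[ eλ ] c → Sim βλ a c

Sim-map : ∀ {n n'} (F : VTm n → VTm n') → (∀ {a l b} → a ⟶v[ l ] b → F a ⟶v[ l ] F b) →
  ∀ {l a b} → Sim l a b → Sim l (F a) (F b)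
Sim-map F f (sim-βi s)    = sim-βi (f s)
Sim-map F f (sim-βλ s s') = sim-βλ (f s) (f s')

-- The explicit substitution created by the m-step simulating a βλ-step is fired by its eλ-step.
esGain : FLabel → ℕ
esGain βλ = 0
esGain βi = 1

record Simulation {n} (l : FLabel) (g : VTm n) (u : Tm n) : Set where
  constructor simulation
  field
    {reduct}   : VTm n
    sim        : Sim l g reduct
    es-gain    : #es reduct ≡ esGain l + #es g
    proper     : Proper reduct
    unf-reduct : unf reduct ≡ u

simulate : ∀ {n} {g : VTm n} → Proper g → ∀ {t l u} → unf g ≡ t → t ⟶f[ l ] u → Simulation l g u
simulate (p-app {g₁} {g₂} p₁ p₂) e (appL _ s) with app-injective e
... | e₁ , refl with simulate p₁ e₁ s
... | simulation sm gain p₁' e₁' =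
  simulation (Sim-map (λ z → vapp z g₂) (appL g₂) sm)
    (trans (cong (_+ #es g₂) gain) (+-assoc _ (#es g₁) (#es g₂)))
    (p-app p₁' p₂) (cong (λ z → app z (unf g₂)) e₁')
simulate (p-app {g₁} {g₂} p₁ p₂) e (appR _ s) with app-injective e
... | refl , e₂ with simulate p₂ e₂ s
... | simulation sm gain p₂' e₂' =
  simulation (Sim-map (vapp g₁) (appR g₁) sm)
    (trans (cong (#es g₁ +_) gain) (x∙yz≈y∙xz (#es g₁) _ (#es g₂)))
    (p-app p₁ p₂') (cong (app (unf g₁)) e₂')
simulate (p-app {u = g₂} p₁ p₂) e (root-i t i) with app-injective e
... | e₁ , refl with Proper-lam⁻¹ p₁ e₁
... | k , L , b , pL , refl =
  simulation (sim-βi (root-m L (emb b) g₂)) gain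
    (plug-Proper pL (p-es (emb-Proper b) (Proper-vren (wkL L) p₂) i'))
    (unf-m-root L (emb b) g₂ e₁)
  where
  i' : Inert (unf (vren (wkL L) g₂))
  i' = subst Inert (sym (unf-vren (wkL L) g₂)) (Inert-ren (wkL L) i)
  gain : #es (plug L (es (emb b) (vren (wkL L) g₂))) ≡ 1 + (#es (plug L (vlam (emb b))) + #es g₂)
  gain = begin
    #es (plug L (es (emb b) (vren (wkL L) g₂)))
      ≡⟨ #es-plug L _ ⟩
    suc (#es (emb b) + #es (vren (wkL L) g₂)) + #esL L
      ≡⟨ cong (λ z → suc z + #esL L) (cong₂ _+_ (#es-emb b) (#es-vren (wkL L) g₂)) ⟩
    suc (#es g₂ + #esL L)
      ≡⟨ cong suc (+-comm (#es g₂) (#esL L)) ⟩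
    suc (#esL L + #es g₂)
      ≡⟨ cong (λ z → suc (z + #es g₂)) (#es-plug L (vlam (emb b))) ⟨
    1 + (#es (plug L (vlam (emb b))) + #es g₂) ∎
    where open ≡-Reasoning
simulate (p-app {u = g₂} p₁ p₂) e (root-λ t t₂) with app-injective e
... | e₁ , e₂ with Proper-lam⁻¹ p₁ e₁
... | k , L , b , pL , refl
  with Proper-lam⁻¹ (Proper-vren (wkL L) p₂) (trans (unf-vren (wkL L) g₂) (cong (ren (wkL L)) e₂))
... | k' , L' , b' , pL' , eq₂ =
  simulation (sim-βλ m-step eλ-step) gain
    (plug-Proper pL (plug-Proper pL' (subst Proper (sym P≡emb) (emb-Proper _)))) unf≡
  where
  b'' : Tm k'
  b'' = ren (liftR (wkL L')) b ⟨0≔ lam b' ⟩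
  P : VTm k'
  P = vren (liftR (wkL L')) (emb b) ⟪0≔ vlam (emb b') ⟫
  P≡emb : P ≡ emb b''
  P≡emb = trans (cong (_⟪0≔ vlam (emb b') ⟫) (vren-emb (liftR (wkL L')) b))
                (emb-⟪0≔⟫ (ren (liftR (wkL L')) b) (lam b'))
  m-step : vapp (plug L (vlam (emb b))) g₂ ⟶v[ m ] plug L (es (emb b) (plug L' (vlam (emb b'))))
  m-step = subst (λ z → _ ⟶v[ m ] plug L (es (emb b) z)) eq₂ (root-m L (emb b) g₂)
  eλ-step : plug L (es (emb b) (plug L' (vlam (emb b')))) ⟶v[ eλ ] plug L (plug L' P)
  eλ-step = plug-step L (root-eλ L' (emb b) (emb b'))
  open ≡-Reasoning
  unf≡ : unf (plug L (plug L' P)) ≡ t ⟨0≔ lam t₂ ⟩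
  unf≡ = begin
    unf (plug L (plug L' P))
      ≡⟨ unf-e-step eλ-step (λ ()) ⟨
    unf (plug L (es (emb b) (plug L' (vlam (emb b')))))
      ≡⟨ cong (λ z → unf (plug L (es (emb b) z))) eq₂ ⟨
    unf (plug L (es (emb b) (vren (wkL L) g₂)))
      ≡⟨ unf-m-root L (emb b) g₂ e₁ ⟩
    t ⟨0≔ unf g₂ ⟩
      ≡⟨ cong (t ⟨0≔_⟩) e₂ ⟩
    t ⟨0≔ lam t₂ ⟩ ∎
  #esL-L'≡ : #esL L' ≡ #es g₂
  #esL-L'≡ = trans (sym (#es-plug L' (vlam (emb b'))))
                   (trans (cong #es (sym eq₂)) (#es-vren (wkL L) g₂))
  gain : #es (plug L (plug L' P)) ≡ 0 + (#es (plug L (vlam (emb b))) + #es g₂)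
  gain = begin
    #es (plug L (plug L' P))
      ≡⟨ #es-plug L _ ⟩
    #es (plug L' P) + #esL L
      ≡⟨ cong (_+ #esL L) (#es-plug L' P) ⟩
    #es P + #esL L' + #esL L
      ≡⟨ cong (λ z → z + #esL L' + #esL L) (trans (cong #es P≡emb) (#es-emb b'')) ⟩
    #esL L' + #esL L
      ≡⟨ +-comm (#esL L') (#esL L) ⟩
    #esL L + #esL L'
      ≡⟨ cong₂ _+_ (sym (#es-plug L (vlam (emb b)))) #esL-L'≡ ⟩
    #es (plug L (vlam (emb b))) + #es g₂ ∎
simulate (p-es {g₁} {c} p₁ q i) {l = l} e s
  with step-sub⁻¹ (single-inert i) (unf g₁) (trans (sym (⟨0≔⟩-sub (unf g₁) (unf c))) e) s
... | t' , s' , e' with simulate p₁ refl s'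
... | simulation {g₁'} sm gain p₁' e₁' =
  simulation (Sim-map (λ z → es z c) (esL c) sm) gain' (p-es p₁' q i)
    (trans (⟨0≔⟩-sub (unf g₁') (unf c)) (trans (cong (sub (single (unf c))) e₁') e'))
  where
  gain' : suc (#es g₁' + #es c) ≡ esGain l + suc (#es g₁ + #es c)
  gain' = trans (cong (λ z → suc (z + #es c)) gain)
         (trans (cong suc (+-assoc (esGain l) (#es g₁) (#es c))) (sym (+-suc (esGain l) _)))

record Simulations {n} {t u : Tm n} (d : Deriv _⟶f[_]_ t u) (g : VTm n) : Set where
  constructor simulations
  field
    {target}   : VTm n
    steps      : Deriv _⟶v[_]_ g target
    proper     : Proper target
    unf-target : unf target ≡ u
    m-count    : len d ≡ countWhere isM steps
    eλ-count   : countWhere isβλ d ≡ countWhere isEλ steps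
    e-count    : countWhere isEλ steps ≡ countWhere isE steps
    es-balance : #es target + countWhere isEλ steps ≡ #es g + countWhere isM steps

simulate* : ∀ {n} {t u : Tm n} (d : Deriv _⟶f[_]_ t u) {g : VTm n} → Proper g → unf g ≡ t →
  Simulations d g
simulate* [] p refl = simulations [] p refl refl refl refl refl
simulate* (s ∷ d) {g} p e with simulate p e s
... | simulation (sim-βi m-step) gain p' e' with simulate* d p' e'
... | simulations steps p'' e'' c₁ c₂ c₃ balance =
  simulations (m-step ∷ steps) p'' e'' (cong suc c₁) c₂ c₃
    (trans balance (trans (cong (_+ countWhere isM steps) gain) (sym (+-suc (#es g) _))))
simulate* (s ∷ d) {g} p e | simulation (sim-βλ m-step eλ-step) gain p' e' with simulate* d p' e'
... | simulations {r} steps p'' e'' c₁ c₂ c₃ balance =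
  simulations (m-step ∷ (eλ-step ∷ steps)) p'' e'' (cong suc c₁) (cong suc c₂) (cong suc c₃)
    (trans (+-suc (#es r) _)
      (trans (cong suc (trans balance (cong (_+ countWhere isM steps) gain)))
        (sym (+-suc (#es g) _))))

-- Structural equivalence and clean forms

unf-vren-suc-⟨0≔⟩ : ∀ {n} (t : VTm n) v → unf (vren suc t) ⟨0≔ v ⟩ ≡ unf t
unf-vren-suc-⟨0≔⟩ t v = trans (⟨0≔⟩-sub (unf (vren suc t)) v) (sub-unf-vren-inverse (λ _ → refl) t)

⟨0≔⟩⟨0≔⟩-sub : ∀ {n} (t : Tm (suc (suc n))) a b →
  t ⟨0≔ a ⟩ ⟨0≔ b ⟩ ≡ sub (sub (single b) ∘ single a) t
⟨0≔⟩⟨0≔⟩-sub t a b = trans (⟨0≔⟩-sub (t ⟨0≔ a ⟩) b)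
  (trans (cong (sub (single b)) (⟨0≔⟩-sub t a)) (sub-sub (single b) (single a) t))

≡s-unf : ∀ {n} {t u : VTm n} → t ≡s u → unf t ≡ unf u
≡s-unf (ax-com {n} t s u) = begin
  unf t ⟨0≔ unf (vren suc s) ⟩ ⟨0≔ unf u ⟩                  ≡⟨ ⟨0≔⟩⟨0≔⟩-sub (unf t) _ _ ⟩
  sub (sub (single (unf u)) ∘ single (unf (vren suc s))) (unf t) ≡⟨ sub-cong exchange (unf t) ⟩
  sub (σ ∘ swap01) (unf t)                                 ≡⟨ sub-ren σ swap01 (unf t) ⟨
  sub σ (ren swap01 (unf t))                               ≡⟨ cong (sub σ) (unf-vren swap01 t) ⟨
  sub σ (unf (vren swap01 t))                              ≡⟨ ⟨0≔⟩⟨0≔⟩-sub (unf (vren swap01 t)) _ _ ⟨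
  unf (vren swap01 t) ⟨0≔ unf (vren suc u) ⟩ ⟨0≔ unf s ⟩    ∎
  where
  open ≡-Reasoning
  σ : Fin (suc (suc n)) → Tm n
  σ = sub (single (unf s)) ∘ single (unf (vren suc u))
  exchange : sub (single (unf u)) ∘ single (unf (vren suc s)) ≗ σ ∘ swap01
  exchange zero          = sub-unf-vren-inverse (λ _ → refl) s
  exchange (suc zero)    = sym (sub-unf-vren-inverse (λ _ → refl) u)
  exchange (suc (suc x)) = refl
≡s-unf (ax-appR t s u) = cong (λ z → app z (unf s ⟨0≔ unf u ⟩)) (sym (unf-vren-suc-⟨0≔⟩ t (unf u)))
≡s-unf (ax-appL t u s) = cong (app (unf t ⟨0≔ unf u ⟩)) (sym (unf-vren-suc-⟨0≔⟩ s (unf u)))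
≡s-unf (ax-es {n} t u s) = begin
  unf t ⟨0≔ unf u ⟨0≔ unf s ⟩ ⟩
    ≡⟨ ⟨0≔⟩-sub (unf t) _ ⟩
  sub (single (unf u ⟨0≔ unf s ⟩)) (unf t)
    ≡⟨ sub-cong lifted (unf t) ⟩
  sub (σ ∘ liftR suc) (unf t)
    ≡⟨ sub-ren σ (liftR suc) (unf t) ⟨
  sub σ (ren (liftR suc) (unf t))
    ≡⟨ cong (sub σ) (unf-vren (liftR suc) t) ⟨
  sub σ (unf (vren (liftR suc) t))
    ≡⟨ ⟨0≔⟩⟨0≔⟩-sub (unf (vren (liftR suc) t)) _ _ ⟨
  unf (vren (liftR suc) t) ⟨0≔ unf u ⟩ ⟨0≔ unf s ⟩ ∎
  where
  open ≡-Reasoning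
  σ : Fin (suc (suc n)) → Tm n
  σ = sub (single (unf s)) ∘ single (unf u)
  lifted : single (unf u ⟨0≔ unf s ⟩) ≗ σ ∘ liftR suc
  lifted zero    = ⟨0≔⟩-sub (unf u) (unf s)
  lifted (suc x) = refl
≡s-unf ≡s-refl          = refl
≡s-unf (≡s-sym p)       = sym (≡s-unf p)
≡s-unf (≡s-trans p q)   = trans (≡s-unf p) (≡s-unf q)
≡s-unf (c-appL u p)     = cong (λ z → app z (unf u)) (≡s-unf p)
≡s-unf (c-appR t p)     = cong (app (unf t)) (≡s-unf p)
≡s-unf (c-esL u p)      = cong (_⟨0≔ unf u ⟩) (≡s-unf p)
≡s-unf (c-esR t p)      = cong (unf t ⟨0≔_⟩) (≡s-unf p)

≡s-setoid : ℕ → Setoid 0ℓ 0ℓ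
≡s-setoid n = record
  { Carrier       = VTm n
  ; _≈_           = _≡s_
  ; isEquivalence = record { refl = ≡s-refl ; sym = ≡s-sym ; trans = ≡s-trans }
  }

module ≡s-Reasoning {n : ℕ} = SetoidReasoning (≡s-setoid n)

≡⇒≡s : ∀ {n} {t u : VTm n} → t ≡ u → t ≡s u
≡⇒≡s refl = ≡s-refl

plug-≡s : ∀ {n k} (L : SCtx n k) {X Y} → X ≡s Y → plug L X ≡s plug L Y
plug-≡s hole       p = p
plug-≡s (L [≔ u ]) p = c-esL u (plug-≡s L p)

_∘L_ : ∀ {n k j} → SCtx n k → SCtx k j → SCtx n j
hole       ∘L L' = L'
(L [≔ u ]) ∘L L' = (L ∘L L') [≔ u ]

plug-∘L : ∀ {n k j} (L : SCtx n k) (L' : SCtx k j) X → plug (L ∘L L') X ≡ plug L (plug L' X)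
plug-∘L hole       L' X = refl
plug-∘L (L [≔ u ]) L' X = cong (λ z → es z u) (plug-∘L L L' X)

vapp-plugˡ : ∀ {n k} (L : SCtx n k) X Y → vapp (plug L X) Y ≡s plug L (vapp X (vren (wkL L) Y))
vapp-plugˡ hole       X Y = ≡⇒≡s (cong (vapp X) (sym (vren-id (λ _ → refl) Y)))
vapp-plugˡ (L [≔ u ]) X Y = begin
  vapp (es (plug L X) u) Y
    ≈⟨ ax-appL (plug L X) u Y ⟩
  es (vapp (plug L X) (vren suc Y)) u
    ≈⟨ c-esL u (vapp-plugˡ L X (vren suc Y)) ⟩
  es (plug L (vapp X (vren (wkL L) (vren suc Y)))) u
    ≡⟨ cong (λ z → es (plug L (vapp X z)) u) (vren-vren (wkL L) suc Y) ⟩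
  es (plug L (vapp X (vren (wkL (L [≔ u ])) Y))) u ∎
  where open ≡s-Reasoning

vapp-plugʳ : ∀ {n k} (L : SCtx n k) X Y → vapp X (plug L Y) ≡s plug L (vapp (vren (wkL L) X) Y)
vapp-plugʳ hole       X Y = ≡⇒≡s (cong (λ z → vapp z Y) (sym (vren-id (λ _ → refl) X)))
vapp-plugʳ (L [≔ u ]) X Y = begin
  vapp X (es (plug L Y) u)
    ≈⟨ ax-appR X (plug L Y) u ⟩
  es (vapp (vren suc X) (plug L Y)) u
    ≈⟨ c-esL u (vapp-plugʳ L (vren suc X) Y) ⟩
  es (plug L (vapp (vren (wkL L) (vren suc X)) Y)) u
    ≡⟨ cong (λ z → es (plug L (vapp z Y)) u) (vren-vren (wkL L) suc X) ⟩
  es (plug L (vapp (vren (wkL (L [≔ u ])) X) Y)) u ∎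
  where open ≡s-Reasoning

es-plug : ∀ {n k} (L : SCtx n k) T Y → es T (plug L Y) ≡s plug L (es (vren (liftR (wkL L)) T) Y)
es-plug hole       T Y = ≡⇒≡s (cong (λ z → es z Y) (sym (vren-id (liftR-id (λ _ → refl)) T)))
es-plug (L [≔ u ]) T Y = begin
  es T (es (plug L Y) u)
    ≈⟨ ax-es T (plug L Y) u ⟩
  es (es (vren (liftR suc) T) (plug L Y)) u
    ≈⟨ c-esL u (es-plug L (vren (liftR suc) T) Y) ⟩
  es (plug L (es (vren (liftR (wkL L)) (vren (liftR suc) T)) Y)) u
    ≡⟨ cong (λ z → es (plug L (es z Y)) u) (vren-liftR-vren (wkL L) suc T) ⟩
  es (plug L (es (vren (liftR (wkL (L [≔ u ]))) T) Y)) u ∎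
  where open ≡s-Reasoning

data CleanL : ∀ {n k} → SCtx n k → Set where
  c-hole : ∀ {n} → CleanL (hole {n})
  c-[≔]  : ∀ {n k} {L : SCtx (suc n) k} {i : Tm n} → CleanL L → Inert i → CleanL (L [≔ emb i ])

CleanL-∘L : ∀ {n k j} {L : SCtx n k} {L' : SCtx k j} → CleanL L → CleanL L' → CleanL (L ∘L L')
CleanL-∘L c-hole      c' = c'
CleanL-∘L (c-[≔] c i) c' = c-[≔] (CleanL-∘L c c') i

plug-Clean : ∀ {n k} {L : SCtx n k} → CleanL L → (b : Tm k) → Clean (plug L (emb b))
plug-Clean c-hole      b = c-body b
plug-Clean (c-[≔] c i) b = c-es (plug-Clean c b) i

record Flattening {n} (t : VTm n) : Set where
  constructor flattening
  field
    {scope} : ℕ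
    ctx     : SCtx n scope
    body    : Tm scope
    clean   : CleanL ctx
    ≡s-flat : t ≡s plug ctx (emb body)

-- Stated for every renaming of a proper term, so that the right subterm of an application
-- can be flattened after weakening it past the context obtained from the left one.
flatten : ∀ {n} {r : VTm n} → Proper r → ∀ {m} (ρ : Ren n m) → Flattening (vren ρ r)
flatten (p-var x) ρ = flattening hole (var (ρ x)) c-hole ≡s-refl
flatten (p-lam t) ρ =
  flattening hole (lam (ren (liftR ρ) t)) c-hole (≡⇒≡s (cong vlam (vren-emb (liftR ρ) t)))
flatten (p-app {r₁} {r₂} p₁ p₂) ρ with flatten p₁ ρ
... | flattening L₁ b₁ c₁ f₁ with flatten p₂ (wkL L₁ ∘ ρ)
... | flattening L₂ b₂ c₂ f₂ =
  flattening (L₁ ∘L L₂) (app (ren (wkL L₂) b₁) b₂) (CleanL-∘L c₁ c₂) (begin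
  vapp (vren ρ r₁) (vren ρ r₂)
    ≈⟨ c-appL _ f₁ ⟩
  vapp (plug L₁ (emb b₁)) (vren ρ r₂)
    ≈⟨ vapp-plugˡ L₁ (emb b₁) (vren ρ r₂) ⟩
  plug L₁ (vapp (emb b₁) (vren (wkL L₁) (vren ρ r₂)))
    ≡⟨ cong (λ z → plug L₁ (vapp (emb b₁) z)) (vren-vren (wkL L₁) ρ r₂) ⟩
  plug L₁ (vapp (emb b₁) (vren (wkL L₁ ∘ ρ) r₂))
    ≈⟨ plug-≡s L₁ (c-appR (emb b₁) f₂) ⟩
  plug L₁ (vapp (emb b₁) (plug L₂ (emb b₂)))
    ≈⟨ plug-≡s L₁ (vapp-plugʳ L₂ (emb b₁) (emb b₂)) ⟩
  plug L₁ (plug L₂ (vapp (vren (wkL L₂) (emb b₁)) (emb b₂)))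
    ≡⟨ cong (λ z → plug L₁ (plug L₂ (vapp z (emb b₂)))) (vren-emb (wkL L₂) b₁) ⟩
  plug L₁ (plug L₂ (emb (app (ren (wkL L₂) b₁) b₂)))
    ≡⟨ plug-∘L L₁ L₂ _ ⟨
  plug (L₁ ∘L L₂) (emb (app (ren (wkL L₂) b₁) b₂)) ∎)
  where open ≡s-Reasoning
flatten (p-es {r₁} {c} p₁ q i) ρ with flatten q ρ
... | flattening Lc bc cc fc with flatten p₁ (liftR (wkL Lc ∘ ρ))
... | flattening L₁ b₁ c₁ f₁ =
  flattening (Lc ∘L (L₁ [≔ emb bc ])) b₁ (CleanL-∘L cc (c-[≔] c₁ bc-inert)) (begin
  es (vren (liftR ρ) r₁) (vren ρ c)
    ≈⟨ c-esR _ fc ⟩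
  es (vren (liftR ρ) r₁) (plug Lc (emb bc))
    ≈⟨ es-plug Lc (vren (liftR ρ) r₁) (emb bc) ⟩
  plug Lc (es (vren (liftR (wkL Lc)) (vren (liftR ρ) r₁)) (emb bc))
    ≡⟨ cong (λ z → plug Lc (es z (emb bc))) (vren-liftR-vren (wkL Lc) ρ r₁) ⟩
  plug Lc (es (vren (liftR (wkL Lc ∘ ρ)) r₁) (emb bc))
    ≈⟨ plug-≡s Lc (c-esL (emb bc) f₁) ⟩
  plug Lc (es (plug L₁ (emb b₁)) (emb bc))
    ≡⟨ plug-∘L Lc (L₁ [≔ emb bc ]) (emb b₁) ⟨
  plug (Lc ∘L (L₁ [≔ emb bc ])) (emb b₁) ∎)
  where
  open ≡s-Reasoning
  bc-inert : Inert bc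
  bc-inert = Inert-sub⁻¹ (unfL Lc) bc (subst Inert unf≡ (Inert-ren ρ i))
    where
    unf≡ : ren ρ (unf c) ≡ sub (unfL Lc) bc
    unf≡ = trans (sym (unf-vren ρ c))
             (trans (≡s-unf fc) (trans (unf-plug Lc (emb bc)) (cong (sub (unfL Lc)) (unf-emb bc))))

Proper⇒Flattening : ∀ {n} {r : VTm n} → Proper r → Flattening r
Proper⇒Flattening {r = r} p with flatten p id
... | flattening L b c flat = flattening L b c (≡s-trans (≡⇒≡s (sym (vren-id (λ _ → refl) r))) flat)

-- Normal forms

data Head : Set where
  hvar hlam happ : Head

head : ∀ {n} → VTm n → Head
head (vvar x)   = hvar
head (vlam t)   = hlam
head (vapp t u) = happ
head (es t u)   = head t

head-plug : ∀ {n k} (L : SCtx n k) X → head (plug L X) ≡ head X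
head-plug hole       X = refl
head-plug (L [≔ u ]) X = head-plug L X

head-vren : ∀ {n m} (ρ : Ren n m) t → head (vren ρ t) ≡ head t
head-vren ρ (vvar x)   = refl
head-vren ρ (vlam t)   = refl
head-vren ρ (vapp t u) = refl
head-vren ρ (es t u)   = head-vren (liftR ρ) t

head-hlam-unf : ∀ {n} (t : VTm n) → head t ≡ hlam → Σ (Tm (suc n)) λ b → unf t ≡ lam b
head-hlam-unf (vlam t) _ = unf t , refl
head-hlam-unf (es t u) h with head-hlam-unf t h
... | _ , e = _ , cong (_⟨0≔ unf u ⟩) e

data Normal {n} : VTm n → Set where
  n-var : ∀ x → Normal (vvar x)
  n-lam : ∀ t → Normal (vlam t)
  n-app : ∀ {t u} → Normal t → Normal u → head t ≢ hlam → Normal (vapp t u)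
  n-es  : ∀ {t u} → Normal t → Normal u → head u ≡ happ → Normal (es t u)

data NormalL : ∀ {n k} → SCtx n k → Set where
  n-hole : ∀ {n} → NormalL (hole {n})
  n-[≔]  : ∀ {n k} {L : SCtx (suc n) k} {u} →
           NormalL L → Normal u → head u ≡ happ → NormalL (L [≔ u ])

Normal⇒vsub-normal : ∀ {n} {t : VTm n} → Normal t → vsub-normal t
Normal⇒vsub-normal (n-app nt nu h) _ _ (root-m L t u)    = h (head-plug L (vlam t))
Normal⇒vsub-normal (n-app nt nu h) l _ (appL u s)        = Normal⇒vsub-normal nt l _ s
Normal⇒vsub-normal (n-app nt nu h) l _ (appR t s)        = Normal⇒vsub-normal nu l _ s
Normal⇒vsub-normal (n-es nt nu h)  _ _ (root-eλ L t v)   with trans (sym (head-plug L (vlam v))) h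
... | ()
Normal⇒vsub-normal (n-es nt nu h)  _ _ (root-evar L t y) with trans (sym (head-plug L (vvar y))) h
... | ()
Normal⇒vsub-normal (n-es nt nu h)  l _ (esL u s)         = Normal⇒vsub-normal nt l _ s
Normal⇒vsub-normal (n-es nt nu h)  l _ (esR t s)         = Normal⇒vsub-normal nu l _ s

Normal-vren : ∀ {n m} (ρ : Ren n m) {t} → Normal t → Normal (vren ρ t)
Normal-vren ρ (n-var x)                = n-var (ρ x)
Normal-vren ρ (n-lam t)                = n-lam _
Normal-vren ρ (n-app {t} nt nu h)      =
  n-app (Normal-vren ρ nt) (Normal-vren ρ nu) (h ∘ trans (sym (head-vren ρ t)))
Normal-vren ρ (n-es {u = u} nt nu h)   =
  n-es (Normal-vren (liftR ρ) nt) (Normal-vren ρ nu) (trans (head-vren ρ u) h)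

plug-Normal : ∀ {n k} {L : SCtx n k} {X} → NormalL L → Normal X → Normal (plug L X)
plug-Normal n-hole           nX = nX
plug-Normal (n-[≔] nL nu h)  nX = n-es (plug-Normal nL nX) nu h

Normal-hvar⁻¹ : ∀ {n} {t : VTm n} → Normal t → head t ≡ hvar →
  Σ ℕ λ k → Σ (SCtx n k) λ L → Σ (Fin k) λ y → NormalL L × t ≡ plug L (vvar y)
Normal-hvar⁻¹ (n-var x) _ = _ , hole , x , n-hole , refl
Normal-hvar⁻¹ (n-es {u = u} nt nu h) h' with Normal-hvar⁻¹ nt h'
... | k , L , y , nL , refl = k , L [≔ u ] , y , n-[≔] nL nu h , refl

evar-appL : ∀ {n} {a : VTm n} {l a'} b → EvarStep a l a' → EvarStep (vapp a b) l (vapp a' b)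
evar-appL b (e , s) = e , appL b s

evar-appR : ∀ {n} (a : VTm n) {b l b'} → EvarStep b l b' → EvarStep (vapp a b) l (vapp a b')
evar-appR a (e , s) = e , appR a s

evar-esL : ∀ {n} {a : VTm (suc n)} {l a'} b → EvarStep a l a' → EvarStep (es a b) l (es a' b)
evar-esL b (e , s) = e , esL b s

evar-esR : ∀ {n} (a : VTm (suc n)) {b l b'} → EvarStep b l b' → EvarStep (es a b) l (es a b')
evar-esR a (e , s) = e , esR a s

record Normalisation {n} (r : VTm n) : Set where
  constructor normalisation
  field
    {nf}       : VTm n
    steps      : Deriv EvarStep r nf
    normal     : Normal nf
    unf-nf     : unf nf ≡ unf r
    evar-bound : countWhere isEvar steps ≤ #es r

-- Each explicit substitution is fired at most once: if it holds a variable, by an e_var-step;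
-- otherwise (it holds an inert application) it stays.
normalise : ∀ {n} {r : VTm n} → Proper r → Fireball (unf r) → Normalisation r
normalise (p-var x) _ = normalisation [] (n-var x) refl z≤n
normalise (p-lam t) _ = normalisation [] (n-lam (emb t)) refl z≤n
normalise (p-app p₁ p₂) (f-in (i-app i f)) with normalise p₁ (f-in i) | normalise p₂ f
... | normalisation {q₁} g₁ n₁ e₁ c₁ | normalisation g₂ n₂ e₂ c₂ =
  normalisation (cong₂ᵈ vapp evar-appL evar-appR g₁ g₂) (n-app n₁ n₂ not-lam) (cong₂ app e₁ e₂)
    (subst (_≤ _) (sym (countWhere-cong₂ᵈ vapp evar-appL evar-appR isEvar g₁ g₂))
           (+-mono-≤ c₁ c₂))
  where
  not-lam : head q₁ ≢ hlam
  not-lam h with head-hlam-unf q₁ h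
  ... | _ , e = Inert≢lam i (trans (sym e₁) e)
normalise (p-es {t} {c} p q i) fb
  with normalise p (Fireball-sub⁻¹ (single (unf c)) (unf t)
                     (subst Fireball (⟨0≔⟩-sub (unf t) (unf c)) fb))
     | normalise q (f-in i)
... | normalisation {qt} gt nt et ct | normalisation {qc} gc nc ec cc = by-head (head qc) refl
  where
  g : Deriv EvarStep (es t c) (es qt qc)
  g = cong₂ᵈ es evar-esL evar-esR gt gc
  g-bound : countWhere isEvar g ≤ #es t + #es c
  g-bound = subst (_≤ _) (sym (countWhere-cong₂ᵈ es evar-esL evar-esR isEvar gt gc))
                  (+-mono-≤ ct cc)
  by-head : ∀ h → head qc ≡ h → Normalisation (es t c)
  by-head hlam h with head-hlam-unf qc h
  ... | _ , e = ⊥-elim (Inert≢lam i (trans (sym ec) e))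
  by-head happ h = normalisation g (n-es nt nc h) (cong₂ _⟨0≔_⟩ et ec) (m≤n⇒m≤1+n g-bound)
  by-head hvar h with Normal-hvar⁻¹ nc h
  ... | k , L , y , nL , refl =
    normalisation (g ++ᵈ ((refl , root-evar L qt y) ∷ [])) (plug-Normal nL n-X)
      (trans (sym (unf-e-step (root-evar L qt y) (λ ()))) (cong₂ _⟨0≔_⟩ et ec))
      (subst (_≤ _) (sym count) (s≤s g-bound))
    where
    n-X : Normal (vren (liftR (wkL L)) qt ⟪0≔ vvar y ⟫)
    n-X = subst Normal (sym (⟪0≔vvar⟫-vren _ y))
                (Normal-vren (singleR y) (Normal-vren (liftR (wkL L)) nt))
    count : countWhere isEvar (g ++ᵈ ((refl , root-evar L qt y) ∷ [])) ≡ suc (countWhere isEvar g)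
    count = trans (countWhere-++ᵈ isEvar g _) (+-comm (countWhere isEvar g) 1)

theorem1 : ∀ {n} (t u : Tm n) (d : Deriv _⟶f[_]_ t u) →
    Σ (VTm n) λ s → Σ (VTm n) λ r → Σ (Deriv _⟶v[_]_ (emb t) r) λ e →
      (r ≡s s × u ≡ unf s × u ≡ unf r × Clean s)
      × (len d ≡ countWhere isM e
         × (countWhere isβλ d ≡ countWhere isEλ e × countWhere isEλ e ≡ countWhere isE e))
      × (β-f-normal u →
          Σ (VTm n) λ q → Σ (Deriv EvarStep r q) λ g →
            vsub-normal q × countWhere isEvar g ≤ countWhere isM e ∸ countWhere isEλ e)
theorem1 {n} t u d with simulate* d (emb-Proper t) (unf-emb t)
... | simulations {r} e proper-r unf-r m-count eλ-count e-count balance with Proper⇒Flattening proper-r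
... | flattening L b clean r≡s =
  plug L (emb b) , r , e ,
  (r≡s , trans (sym unf-r) (≡s-unf r≡s) , sym unf-r , plug-Clean clean b) ,
  (m-count , eλ-count , e-count) ,
  normal-form
  where
  #es-r : #es r ≡ countWhere isM e ∸ countWhere isEλ e
  #es-r = trans (sym (m+n∸n≡m (#es r) (countWhere isEλ e)))
                (cong (_∸ countWhere isEλ e) (trans balance (cong (_+ countWhere isM e) (#es-emb t))))
  normal-form : β-f-normal u → Σ (VTm n) λ q → Σ (Deriv EvarStep r q) λ g →
    vsub-normal q × countWhere isEvar g ≤ countWhere isM e ∸ countWhere isEλ e
  normal-form u-normal with normalise proper-r (subst Fireball (sym unf-r) (normal⇒Fireball u u-normal))
  ... | normalisation g q-normal _ bound =
    _ , g , Normal⇒vsub-normal q-normal , subst (countWhere isEvar g ≤_) #es-r bound
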